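{- Let $k\ge2$, let $G$ be a graph, let $\mathcal{P}$ be the $k^+$-star packing output by the algorithm LocalSearch-$k^+$ on $G$, and let $\mathcal{Q}^*$ be a $k^+$-star packing of $G$ covering the maximum number of vertices. Call a star of $\mathcal{Q}^*$ Type-1 if it contains exactly $k$ vertices not covered by $\mathcal{P}$, let $Apx_1$ be the total number of vertices covered by $\mathcal{P}$ lying in Type-1 stars of $\mathcal{Q}^*$, and call a satellite of a Type-1 star of $\mathcal{Q}^*$ that is covered by $\mathcal{P}$ a c-vertex. Then there are exactly $Apx_1$ c-vertices, and each c-vertex is a satellite of an internal $k$-star of $\mathcal{P}$, with distinct c-vertices lying in distinct internal $k$-stars of $\mathcal{P}$.
   Context: For $\ell\ge1$, an $\ell$-star is a graph with one center vertex of degree $\ell$ adjacent to $\ell$ degree-$1$ satellites; a $k^+$-star is an $\ell$-star with $\ell\ge k$. A $k^+$-star packing of $G=(V,E)$ is a set of vertex-disjoint subgraphs of $G$ each a $k^+$-star; a vertex is covered if it lies in one of them. Stars of $\mathcal{P}$ are called internal stars. Algorithm LocalSearch-$k^+$: it maintains a $k^+$-star packing $\mathcal{P}$ and the remainder graph $R=G[V\setminus V(\mathcal{P})]$. Operations: Collect($v$): for a vertex $v$ of $R$ with degree $\ell\ge k$ in $R$, extract the $\ell$-star formed by $v$ and all its $R$-neighbours and add it to $\mathcal{P}$. Pull-by-$(k+1)^+$: given a satellite $v$ of an internal $(k+1)^+$-star, remove $v$ from that star and apply Collect to extract a $k^+$-star. Pull-by-$k$: given an internal $k$-star, remove it and apply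 Collect operations to extract a $(k+1)^+$-star, or if not possible two vertex-disjoint $k$-stars. Pull-by-$(k,(k+1)^+)$: remove an internal $k$-star and one satellite of an internal $(k+1)^+$-star and apply Collect operations to extract two vertex-disjoint $k^+$-stars. Pull-by-$(k,k)$: remove two internal $k$-stars and apply Collect operations to extract either vertex-disjoint $k^+$-star and $(k+1)^+$-star, or three vertex-disjoint $k$-stars. Starting from $\mathcal{P}=\emptyset$, while some Collect or Pull operation is applicable (can be carried out as described), apply it, then re-apply Collect on the center of every internal star (adding all uncovered neighbours of the center to that star) and update $R$; when none is applicable, output $\mathcal{P}$. -}

module Defs where

open import Data.Nat using (ℕ; _≤_; suc)
open import Data.Fin using (Fin; _≟_)
open import Data.List using (List; []; _∷_; _++_; length; filter; concatMap; map)
open import Data.Nat.ListAction using (sum)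
open import Data.List.Membership.Propositional using (_∈_; _∉_)
open import Data.List.Relation.Unary.Unique.Propositional using (Unique)
open import Data.List.Relation.Unary.All using (All)
open import Data.List.Relation.Binary.Permutation.Propositional using (_↭_)
open import Relation.Binary.Construct.Closure.ReflexiveTransitive using (Star)
open import Data.Product using (Σ; ∃; ∃-syntax; _×_; _,_)
open import Data.Sum using (_⊎_)
open import Relation.Nullary using (¬_; ¬?)
open import Relation.Binary.PropositionalEquality using (_≡_)
open import Function.Bundles using (_⇔_)
import Data.List.Membership.DecPropositional as DecMem

record Graph (n : ℕ) : Set₁ where
  field
    Adj    : Fin n → Fin n → Set
    sym    : ∀ {u v} → Adj u v → Adj v u
    irrefl : ∀ {u} → ¬ Adj u u
open Graph public

record StarG (n : ℕ) : Set where
  constructor star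
  field
    center : Fin n
    sats   : List (Fin n)
open StarG public

Packing : ℕ → Set
Packing n = List (StarG n)

module _ {n : ℕ} where
  open DecMem (_≟_ {n}) using (_∈?_)

  starVerts : StarG n → List (Fin n)
  starVerts s = center s ∷ sats s

  verts : Packing n → List (Fin n)
  verts P = concatMap starVerts P

  IsKStarPacking : ℕ → Graph n → Packing n → Set
  IsKStarPacking k G Q =
    Unique (verts Q) ×
    All (λ s → k ≤ length (sats s) × All (Adj G (center s)) (sats s)) Q

  IsMaxKStarPacking : ℕ → Graph n → Packing n → Set
  IsMaxKStarPacking k G Q =
    IsKStarPacking k G Q ×
    (∀ Q' → IsKStarPacking k G Q' → length (verts Q') ≤ length (verts Q))

  CollectStep : Graph n → ℕ → Packing n → StarG n → Set
  CollectStep G k P s =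
    center s ∉ verts P ×
    (∀ u → (u ∈ sats s) ⇔ (Adj G (center s) u × u ∉ verts P)) ×
    Unique (sats s) ×
    k ≤ length (sats s)

  data Collects (G : Graph n) (k : ℕ) : Packing n → List (StarG n) → Set where
    done : ∀ {P} → Collects G k P []
    step : ∀ {P s ts} → CollectStep G k P s → Collects G k (s ∷ P) ts →
           Collects G k P (s ∷ ts)

  data Op (G : Graph n) (k : ℕ) : Packing n → Packing n → Set where
    collect  : ∀ {P s} → CollectStep G k P s → Op G k P (s ∷ P)
    pullBig  : ∀ {P s rest xs v ys t} →
               P ↭ (s ∷ rest) → sats s ≡ xs ++ (v ∷ ys) → suc k ≤ length (sats s) →
               CollectStep G k (star (center s) (xs ++ ys) ∷ rest) t →
               Op G k P (t ∷ star (center s) (xs ++ ys) ∷ rest)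
    pullK₁   : ∀ {P s rest t} →
               P ↭ (s ∷ rest) → length (sats s) ≡ k →
               CollectStep G k rest t → suc k ≤ length (sats t) →
               Op G k P (t ∷ rest)
    pullK₂   : ∀ {P s rest t₁ t₂} →
               P ↭ (s ∷ rest) → length (sats s) ≡ k →
               ¬ (∃[ t ] (CollectStep G k rest t × suc k ≤ length (sats t))) →
               Collects G k rest (t₁ ∷ t₂ ∷ []) →
               length (sats t₁) ≡ k → length (sats t₂) ≡ k →
               Op G k P (t₂ ∷ t₁ ∷ rest)
    pullKBig : ∀ {P s₁ s₂ rest xs v ys t₁ t₂} →
               P ↭ (s₁ ∷ s₂ ∷ rest) → length (sats s₁) ≡ k →
               sats s₂ ≡ xs ++ (v ∷ ys) → suc k ≤ length (sats s₂) →
               Collects G k (star (center s₂) (xs ++ ys) ∷ rest) (t₁ ∷ t₂ ∷ []) →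
               Op G k P (t₂ ∷ t₁ ∷ star (center s₂) (xs ++ ys) ∷ rest)
    pullKK₁  : ∀ {P s₁ s₂ rest t₁ t₂} →
               P ↭ (s₁ ∷ s₂ ∷ rest) → length (sats s₁) ≡ k → length (sats s₂) ≡ k →
               Collects G k rest (t₁ ∷ t₂ ∷ []) →
               (suc k ≤ length (sats t₁) ⊎ suc k ≤ length (sats t₂)) →
               Op G k P (t₂ ∷ t₁ ∷ rest)
    pullKK₂  : ∀ {P s₁ s₂ rest t₁ t₂ t₃} →
               P ↭ (s₁ ∷ s₂ ∷ rest) → length (sats s₁) ≡ k → length (sats s₂) ≡ k →
               Collects G k rest (t₁ ∷ t₂ ∷ t₃ ∷ []) →
               length (sats t₁) ≡ k → length (sats t₂) ≡ k → length (sats t₃) ≡ k →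
               Op G k P (t₃ ∷ t₂ ∷ t₁ ∷ rest)

  data Extend (G : Graph n) : Packing n → Packing n → Set where
    extend : ∀ {P s rest ns} →
             P ↭ (s ∷ rest) → Unique ns →
             (∀ u → (u ∈ ns) ⇔ (Adj G (center s) u × u ∉ verts P)) →
             Extend G P (star (center s) (sats s ++ ns) ∷ rest)

  -- after re-collecting at every center, no center has an uncovered neighbour
  Closed : Graph n → Packing n → Set
  Closed G P = ∀ s → s ∈ P → ∀ u → Adj G (center s) u → u ∈ verts P

  data Reachable (G : Graph n) (k : ℕ) : Packing n → Set where
    start : Reachable G k []
    iter  : ∀ {P P₁ P₂} → Reachable G k P → Op G k P P₁ →
            Star (Extend G) P₁ P₂ → Closed G P₂ → Reachable G k P₂

  IsOutput : Graph n → ℕ → Packing n → Set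
  IsOutput G k P = Reachable G k P × (∀ P' → ¬ Op G k P P')

  uncovCount : Packing n → StarG n → ℕ
  uncovCount P t = length (filter (λ u → ¬? (u ∈? verts P)) (starVerts t))

  type1Stars : ℕ → Packing n → Packing n → Packing n
  type1Stars k P Q = filter (λ t → uncovCount P t Data.Nat.≟ k) Q

  Apx₁ : ℕ → Packing n → Packing n → ℕ
  Apx₁ k P Q = sum (map (λ t → length (filter (λ u → u ∈? verts P) (starVerts t)))
                        (type1Stars k P Q))

  cVertices : ℕ → Packing n → Packing n → List (Fin n)
  cVertices k P Q = concatMap (λ t → filter (λ u → u ∈? verts P) (sats t))
                              (type1Stars k P Q)

{-# OPTIONS --safe #-}

-- Each step exhibits a Collect or Pull operation that would apply to P, contradicting that
-- LocalSearch-k⁺ stopped at P. First, the center x of a Type-1 star t of Q is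
-- uncovered: if x were the center of an internal star, closedness would cover the k ≥ 1
-- uncovered satellites of t; if x were a satellite of an internal k-star s, removing s
-- would let x collect its center and the k uncovered vertices of t; if x were a satellite
-- of a (k+1)⁺-star, pulling x would let it collect the uncovered vertices of t. Hence the
-- covered vertices of t are satellites (this gives the count), and for a c-vertex c of t,
-- x together with c and the k − 1 uncovered satellites of t forms a k-star once c is
-- released. Pulling c out of a (k+1)⁺-star would let x collect this star, so c lies in an
-- internal k-star s. Removing s releases both c-vertices c ≠ c′ it might contain: with a
-- common center this yields a (k+1)-star, with distinct centers two disjoint k-stars, and
-- in both cases Pull-by-k applies.

module Submission where

open import Defs
open import Data.Nat using (ℕ; zero; suc; _+_; _≤_; _<_; z≤n; s≤s)
open import Data.Nat.Properties
  using ( ≤-trans; ≤-reflexive; ≤-antisym; ≤-pred; <⇒≱; ≮⇒≥; <⇒≤; m≤m+n; n≤1+n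
        ; m≤n⇒m<n∨m≡n; module ≤-Reasoning)
open import Data.Nat.ListAction using (sum)
open import Data.Fin using (Fin; _≟_)
open import Data.List using (List; []; _∷_; _++_; [_]; length; filter; concatMap; map; allFin; _ʳ++_)
open import Data.List.Properties using (length-++; ++-assoc; filter-accept; filter-reject)
open import Data.List.Membership.Propositional using (_∈_; _∉_; find; lose)
open import Data.List.Membership.Propositional.Properties
  using ( ∈-++⁺ˡ; ∈-++⁺ʳ; ∈-++⁻; ∈-∃++; ∈-filter⁺; ∈-filter⁻; ∈-allFin
        ; ∈-concatMap⁺; ∈-concatMap⁻)
import Data.List.Membership.DecPropositional as DecMembership
open import Data.List.Relation.Unary.Any using (here; there)
open import Data.List.Relation.Unary.All as All using (All; []; _∷_)
open import Data.List.Relation.Unary.All.Properties using (¬Any⇒All¬; All¬⇒¬Any)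
import Data.List.Relation.Unary.All.Properties as All
open import Data.List.Relation.Unary.AllPairs as AllPairs using ([]; _∷_)
open import Data.List.Relation.Unary.Unique.Propositional using (Unique)
import Data.List.Relation.Unary.Unique.Propositional.Properties as Unique
open import Data.List.Relation.Binary.Disjoint.Propositional using (Disjoint)
open import Data.List.Relation.Binary.Subset.Propositional using (_⊆_)
open import Data.List.Relation.Binary.Permutation.Propositional
  using (_↭_; ↭-sym; ↭-trans; ↭⇒↭ₛ; module PermutationReasoning)
import Data.List.Relation.Binary.Permutation.Propositional as ↭
open import Data.List.Relation.Binary.Permutation.Propositional.Properties
  using (All-resp-↭; ∈-resp-↭; ↭-length; shift; shifts; ++⁺ˡ)
import Data.List.Relation.Binary.Permutation.Setoid.Properties as PermutationSetoid
open import Relation.Binary.Construct.Closure.ReflexiveTransitive using (Star; ε; _◅_)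
open import Data.Product using (∃-syntax; ∃₂; _×_; _,_; proj₁; proj₂)
open import Data.Sum using (_⊎_; inj₁; inj₂; [_,_]′)
open import Data.Empty using (⊥; ⊥-elim)
open import Function using (_∘_)
open import Function.Bundles using (_⇔_; mk⇔; Equivalence)
open import Relation.Binary using (Decidable)
open import Relation.Nullary using (¬_; yes; no; ¬?; _×-dec_)
open import Relation.Nullary.Decidable using (¬¬-excluded-middle)
open import Relation.Binary.PropositionalEquality
  using (_≡_; _≢_; refl; cong; cong₂; subst; setoid; module ≡-Reasoning)
import Relation.Binary.PropositionalEquality as ≡

private variable
  A B : Set

Unique-resp-↭ : {xs ys : List A} → xs ↭ ys → Unique xs → Unique ys
Unique-resp-↭ {A = A} p = PermutationSetoid.Unique-resp-↭ (setoid A) (↭⇒↭ₛ p)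

Unique-++⁻ˡ : ∀ (xs : List A) {ys} → Unique (xs ++ ys) → Unique xs
Unique-++⁻ˡ []       _         = []
Unique-++⁻ˡ (x ∷ xs) (x∉ ∷ u) = ¬Any⇒All¬ xs (All¬⇒¬Any x∉ ∘ ∈-++⁺ˡ) ∷ Unique-++⁻ˡ xs u

Unique-++⁻ʳ : ∀ (xs : List A) {ys} → Unique (xs ++ ys) → Unique ys
Unique-++⁻ʳ []       u       = u
Unique-++⁻ʳ (_ ∷ xs) (_ ∷ u) = Unique-++⁻ʳ xs u

Unique-++⇒Disjoint : ∀ (xs : List A) {ys} → Unique (xs ++ ys) → Disjoint xs ys
Unique-++⇒Disjoint (x ∷ xs) (x∉ ∷ _) (here refl , v∈ys) = All¬⇒¬Any x∉ (∈-++⁺ʳ xs v∈ys)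
Unique-++⇒Disjoint (x ∷ xs) (_ ∷ u)  (there v∈xs , v∈ys) = Unique-++⇒Disjoint xs u (v∈xs , v∈ys)

↭-++⇒∉ʳ : ∀ {zs xs ys : List A} {x} → Unique zs → zs ↭ xs ++ ys → x ∉ zs ⊎ x ∈ xs → x ∉ ys
↭-++⇒∉ʳ {xs = xs} _ p (inj₁ x∉zs) x∈ys = x∉zs (∈-resp-↭ (↭-sym p) (∈-++⁺ʳ xs x∈ys))
↭-++⇒∉ʳ {xs = xs} u p (inj₂ x∈xs) x∈ys = Unique-++⇒Disjoint xs (Unique-resp-↭ p u) (x∈xs , x∈ys)

∈⇒↭-∷ : ∀ {x : A} {xs} → x ∈ xs → ∃[ rest ] (xs ↭ x ∷ rest)
∈⇒↭-∷ {x = x} x∈xs with ys , zs , refl ← ∈-∃++ x∈xs = ys ++ zs , shift x ys zs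

Unique-⊆⇒length-≤ : {xs ys : List A} → Unique xs → xs ⊆ ys → length xs ≤ length ys
Unique-⊆⇒length-≤ {xs = []}     _          _   = z≤n
Unique-⊆⇒length-≤ {xs = x ∷ xs} (x∉ ∷ u) sub with rest , ys↭ ← ∈⇒↭-∷ (sub (here refl)) =
  subst (suc (length xs) ≤_) (≡.sym (↭-length ys↭)) (s≤s (Unique-⊆⇒length-≤ u xs⊆rest))
  where
  xs⊆rest : xs ⊆ rest
  xs⊆rest y∈xs with ∈-resp-↭ ys↭ (sub (there y∈xs))
  ... | here refl     = ⊥-elim (All¬⇒¬Any x∉ y∈xs)
  ... | there y∈rest = y∈rest

Unique-⊆-∉⇒length-< : ∀ {xs ys : List A} {y} → Unique xs → xs ⊆ ys → y ∈ ys → y ∉ xs →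
                      length xs < length ys
Unique-⊆-∉⇒length-< {xs = xs} u sub y∈ys y∉xs =
  Unique-⊆⇒length-≤ (¬Any⇒All¬ xs y∉xs ∷ u) λ { (here refl) → y∈ys ; (there m) → sub m }

∈-concatMap⁺′ : ∀ (f : A → List B) {xs x y} → x ∈ xs → y ∈ f x → y ∈ concatMap f xs
∈-concatMap⁺′ f x∈xs y∈fx = ∈-concatMap⁺ f (lose x∈xs y∈fx)

∈-concatMap⁻′ : ∀ (f : A → List B) {xs y} → y ∈ concatMap f xs → ∃[ x ] (x ∈ xs × y ∈ f x)
∈-concatMap⁻′ f y∈ = find (∈-concatMap⁻ f y∈)

concatMap-↭ : ∀ (f : A → List B) {xs ys} → xs ↭ ys → concatMap f xs ↭ concatMap f ys
concatMap-↭ f ↭.refl         = ↭.refl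
concatMap-↭ f (↭.prep x p)   = ++⁺ˡ (f x) (concatMap-↭ f p)
concatMap-↭ f (↭.swap x y p) = ↭-trans (shifts (f x) (f y)) (++⁺ˡ (f y) (++⁺ˡ (f x) (concatMap-↭ f p)))
concatMap-↭ f (↭.trans p q)  = ↭-trans (concatMap-↭ f p) (concatMap-↭ f q)

Unique-concatMap⁻ : ∀ (f : A → List B) {xs x} → Unique (concatMap f xs) → x ∈ xs → Unique (f x)
Unique-concatMap⁻ f {y ∷ _} u (here refl) = Unique-++⁻ˡ (f y) u
Unique-concatMap⁻ f {y ∷ _} u (there x∈) = Unique-concatMap⁻ f (Unique-++⁻ʳ (f y) u) x∈

Unique-concatMap-overlap : ∀ (f : A → List B) {xs x x′ v} → Unique (concatMap f xs) →
                           x ∈ xs → x′ ∈ xs → v ∈ f x → v ∈ f x′ → x ≡ x′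
Unique-concatMap-overlap f {y ∷ _} u (here refl) (here refl) _ _ = refl
Unique-concatMap-overlap f {y ∷ _} u (here refl) (there x′∈) v∈ v∈′ =
  ⊥-elim (Unique-++⇒Disjoint (f y) u (v∈ , ∈-concatMap⁺′ f x′∈ v∈′))
Unique-concatMap-overlap f {y ∷ _} u (there x∈) (here refl) v∈ v∈′ =
  ⊥-elim (Unique-++⇒Disjoint (f y) u (v∈′ , ∈-concatMap⁺′ f x∈ v∈))
Unique-concatMap-overlap f {y ∷ _} u (there x∈) (there x′∈) =
  Unique-concatMap-overlap f (Unique-++⁻ʳ (f y) u) x∈ x′∈

length-concatMap : ∀ (f : A → List B) (g : A → ℕ) {xs} → All (λ x → length (f x) ≡ g x) xs →
                   length (concatMap f xs) ≡ sum (map g xs)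
length-concatMap f g []                = refl
length-concatMap f g {x ∷ xs} (e ∷ es) = begin
  length (f x ++ concatMap f xs)         ≡⟨ length-++ (f x) ⟩
  length (f x) + length (concatMap f xs) ≡⟨ cong₂ _+_ e (length-concatMap f g es) ⟩
  g x + sum (map g xs)                   ∎
  where open ≡-Reasoning

∃∈-of-length-≥1 : {xs : List A} → 1 ≤ length xs → ∃[ x ] (x ∈ xs)
∃∈-of-length-≥1 {xs = x ∷ _} _ = x , here refl

¬¬-∀-Fin : ∀ {m} {P : Fin m → Set} → (∀ i → ¬ ¬ P i) → ¬ ¬ (∀ i → P i)
¬¬-∀-Fin {zero}  h ¬∀ = ¬∀ λ ()
¬¬-∀-Fin {suc m} h ¬∀ = h Fin.zero λ p₀ → ¬¬-∀-Fin (h ∘ Fin.suc) λ ps →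
  ¬∀ λ { Fin.zero → p₀ ; (Fin.suc i) → ps i }

-- Collect needs the list of all uncovered neighbours, hence decidable adjacency; its double
-- negation suffices because every appeal to an operation below ends in a contradiction.
¬¬-decidable : ∀ {m} (R : Fin m → Fin m → Set) → ¬ ¬ Decidable R
¬¬-decidable R = ¬¬-∀-Fin λ u → ¬¬-∀-Fin λ v → ¬¬-excluded-middle

module _ {n : ℕ} (G : Graph n) where

  StarIn : (Fin n → Set) → StarG n → Set
  StarIn Free s = Free (center s) × Unique (sats s) × All (λ u → Adj G (center s) u × Free u) (sats s)

  InRemainder : Packing n → StarG n → Set
  InRemainder B = StarIn (_∉ verts B)

module _ {n : ℕ} {G : Graph n} where

  StarIn-mono : ∀ {F F′ : Fin n → Set} {s} → (∀ {u} → u ∈ starVerts s → F u → F′ u) →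
                StarIn G F s → StarIn G F′ s
  StarIn-mono f (Fc , uniq , nbrs) =
    f (here refl) Fc , uniq ,
    All.tabulate λ m → let adj , Fu = All.lookup nbrs m in adj , f (there m) Fu

  StarIn-∷ : ∀ {F : Fin n → Set} {s u} → StarIn G F s → Adj G (center s) u → F u → u ∉ sats s →
             StarIn G F (star (center s) (u ∷ sats s))
  StarIn-∷ {s = s} (Fc , uniq , nbrs) adj Fu u∉ = Fc , ¬Any⇒All¬ (sats s) u∉ ∷ uniq , (adj , Fu) ∷ nbrs

  InRemainder-∷ : ∀ {B s t} → InRemainder G B t → Disjoint (starVerts t) (starVerts s) →
                  InRemainder G (s ∷ B) t
  InRemainder-∷ {B} {s} {t} r disj = StarIn-mono fresh r
    where
    fresh : ∀ {u} → u ∈ starVerts t → u ∉ verts B → u ∉ starVerts s ++ verts B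
    fresh u∈t u∉B m = [ (λ u∈s → disj (u∈t , u∈s)) , u∉B ]′ (∈-++⁻ (starVerts s) m)

  Unique-verts-∷ : ∀ {B t} → InRemainder G B t → Unique (verts B) → Unique (verts (t ∷ B))
  Unique-verts-∷ {B} {t} (c∉ , sats-unique , nbrs) uniq =
    ¬Any⇒All¬ _ center-fresh ∷
    Unique.++⁺ sats-unique uniq λ (u∈t , u∈B) → proj₂ (All.lookup nbrs u∈t) u∈B
    where
    center-fresh : center t ∉ sats t ++ verts B
    center-fresh m with ∈-++⁻ (sats t) m
    ... | inj₁ c∈t = irrefl G (proj₁ (All.lookup nbrs c∈t))
    ... | inj₂ c∈B = c∉ c∈B

  CollectStep⇒InRemainder : ∀ {k B t} → CollectStep G k B t → InRemainder G B t
  CollectStep⇒InRemainder (c∉ , nbrs , uniq , _) = c∉ , uniq , All.tabulate (Equivalence.to (nbrs _))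

module _ {n : ℕ} where

  verts-↭ : {P P′ : Packing n} → P ↭ P′ → verts P ↭ verts P′
  verts-↭ = concatMap-↭ starVerts

  verts-removeSatellite : ∀ {s : StarG n} {rest xs v ys} → sats s ≡ xs ++ v ∷ ys →
                          verts (s ∷ rest) ↭ v ∷ verts (star (center s) (xs ++ ys) ∷ rest)
  verts-removeSatellite {s} {rest} {xs} {v} {ys} eq rewrite eq = begin
    center s ∷ (xs ++ v ∷ ys) ++ R ≡⟨ cong (center s ∷_) (++-assoc xs (v ∷ ys) R) ⟩
    center s ∷ xs ++ v ∷ ys ++ R   ↭⟨ shift v (center s ∷ xs) (ys ++ R) ⟩
    v ∷ center s ∷ xs ++ ys ++ R   ≡⟨ cong (λ zs → v ∷ center s ∷ zs) (++-assoc xs ys R) ⟨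
    v ∷ center s ∷ (xs ++ ys) ++ R ∎
    where
    R = verts rest
    open PermutationReasoning

  verts-extend : ∀ (s : StarG n) ns rest →
                 verts (star (center s) (sats s ++ ns) ∷ rest) ↭ ns ++ verts (s ∷ rest)
  verts-extend s ns rest = begin
    center s ∷ (sats s ++ ns) ++ verts rest ≡⟨ cong (center s ∷_) (++-assoc (sats s) ns (verts rest)) ⟩
    starVerts s ++ ns ++ verts rest         ↭⟨ shifts (starVerts s) ns ⟩
    ns ++ starVerts s ++ verts rest         ∎
    where open PermutationReasoning

module _ {n : ℕ} {G : Graph n} {k : ℕ} where

  private
    IsPacking : Packing n → Set
    IsPacking = IsKStarPacking k G

  IsKStarPacking-resp-↭ : {P P′ : Packing n} → P ↭ P′ → IsPacking P → IsPacking P′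
  IsKStarPacking-resp-↭ p (uniq , stars) = Unique-resp-↭ (verts-↭ p) uniq , All-resp-↭ p stars

  IsKStarPacking-tail : ∀ {s rest} → IsPacking (s ∷ rest) → IsPacking rest
  IsKStarPacking-tail {s} (uniq , _ ∷ stars) = Unique-++⁻ʳ (starVerts s) uniq , stars

  IsKStarPacking-collect : ∀ {B t} → CollectStep G k B t → IsPacking B → IsPacking (t ∷ B)
  IsKStarPacking-collect {B} c@(_ , _ , _ , len) (uniq , stars)
    with r@(_ , _ , nbrs) ← CollectStep⇒InRemainder {G = G} {B = B} c =
    Unique-verts-∷ {G = G} {B = B} r uniq , (len , All.map proj₁ nbrs) ∷ stars

  IsKStarPacking-collects : ∀ {B ts} → Collects G k B ts → IsPacking B → IsPacking (ts ʳ++ B)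
  IsKStarPacking-collects done        pk = pk
  IsKStarPacking-collects (step c cs) pk = IsKStarPacking-collects cs (IsKStarPacking-collect c pk)

  IsKStarPacking-removeSatellite : ∀ {s rest xs v ys} → sats s ≡ xs ++ v ∷ ys →
                                   suc k ≤ length (sats s) → IsPacking (s ∷ rest) →
                                   IsPacking (star (center s) (xs ++ ys) ∷ rest)
  IsKStarPacking-removeSatellite {s} {rest} {xs} {v} {ys} eq big (uniq , (_ , adj) ∷ stars) =
    AllPairs.tail (Unique-resp-↭ (verts-removeSatellite {rest = rest} eq) uniq) ,
    (≤-pred (subst (suc k ≤_) length-sats big) ,
     All.tail (All-resp-↭ (shift v xs ys) (subst (All (Adj G (center s))) eq adj))) ∷ stars
    where
    length-sats : length (sats s) ≡ suc (length (xs ++ ys))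
    length-sats = ↭-length (subst (_↭ v ∷ xs ++ ys) (≡.sym eq) (shift v xs ys))

  IsKStarPacking-extend : ∀ {P P′} → Extend G P P′ → IsPacking P → IsPacking P′
  IsKStarPacking-extend (extend {s = s} {rest} {ns} p ns-unique ns-nbrs) pk
    with uniq , (len , adj) ∷ stars ← IsKStarPacking-resp-↭ p pk =
    Unique-resp-↭ (↭-sym (verts-extend s ns rest)) (Unique.++⁺ ns-unique uniq ns-fresh) ,
    (≤-trans len (subst (length (sats s) ≤_) (≡.sym (length-++ (sats s))) (m≤m+n _ _)) ,
     All.++⁺ adj (All.tabulate (proj₁ ∘ Equivalence.to (ns-nbrs _)))) ∷ stars
    where
    ns-fresh : Disjoint ns (verts (s ∷ rest))
    ns-fresh (u∈ns , u∈s∷rest) =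
      proj₂ (Equivalence.to (ns-nbrs _) u∈ns) (∈-resp-↭ (verts-↭ (↭-sym p)) u∈s∷rest)

  IsKStarPacking-op : ∀ {P P′} → Op G k P P′ → IsPacking P → IsPacking P′
  IsKStarPacking-op (collect c) pk = IsKStarPacking-collect c pk
  IsKStarPacking-op (pullBig p eq big c) pk =
    IsKStarPacking-collect c (IsKStarPacking-removeSatellite eq big (IsKStarPacking-resp-↭ p pk))
  IsKStarPacking-op (pullK₁ p _ c _) pk =
    IsKStarPacking-collect c (IsKStarPacking-tail (IsKStarPacking-resp-↭ p pk))
  IsKStarPacking-op (pullK₂ p _ _ cs _ _) pk =
    IsKStarPacking-collects cs (IsKStarPacking-tail (IsKStarPacking-resp-↭ p pk))
  IsKStarPacking-op (pullKBig p _ eq big cs) pk =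
    IsKStarPacking-collects cs
      (IsKStarPacking-removeSatellite eq big (IsKStarPacking-tail (IsKStarPacking-resp-↭ p pk)))
  IsKStarPacking-op (pullKK₁ p _ _ cs _) pk =
    IsKStarPacking-collects cs (IsKStarPacking-tail (IsKStarPacking-tail (IsKStarPacking-resp-↭ p pk)))
  IsKStarPacking-op (pullKK₂ p _ _ cs _ _ _) pk =
    IsKStarPacking-collects cs (IsKStarPacking-tail (IsKStarPacking-tail (IsKStarPacking-resp-↭ p pk)))

  reachable⇒IsKStarPacking : ∀ {P} → Reachable G k P → IsPacking P
  reachable⇒IsKStarPacking start          = [] , []
  reachable⇒IsKStarPacking (iter r o es _) = extends es (IsKStarPacking-op o (reachable⇒IsKStarPacking r))
    where
    extends : ∀ {P P′} → Star (Extend G) P P′ → IsPacking P → IsPacking P′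
    extends ε        pk = pk
    extends (e ◅ es) pk = extends es (IsKStarPacking-extend e pk)

  reachable⇒Closed : ∀ {P} → Reachable G k P → Closed G P
  reachable⇒Closed start            _ ()
  reachable⇒Closed (iter _ _ _ closed) = closed

module KStarPacking {n : ℕ} {G : Graph n} {k : ℕ} {B : Packing n} (pk : IsKStarPacking k G B) where

  sats-unique : ∀ {t} → t ∈ B → Unique (sats t)
  sats-unique t∈B = AllPairs.tail (Unique-concatMap⁻ starVerts (proj₁ pk) t∈B)

  center-adjacent : ∀ {t u} → t ∈ B → u ∈ sats t → Adj G (center t) u
  center-adjacent t∈B = All.lookup (proj₂ (All.lookup (proj₂ pk) t∈B))

  stars-disjoint : ∀ {t t′} → t ∈ B → t′ ∈ B → center t ≢ center t′ →
                   Disjoint (starVerts t) (starVerts t′)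
  stars-disjoint t∈B t′∈B x≢x′ (u∈t , u∈t′) =
    x≢x′ (cong center (Unique-concatMap-overlap starVerts (proj₁ pk) t∈B t′∈B u∈t u∈t′))

  kStar⊎bigStar : ∀ {t} → t ∈ B → length (sats t) ≡ k ⊎ suc k ≤ length (sats t)
  kStar⊎bigStar t∈B with m≤n⇒m<n∨m≡n (proj₁ (All.lookup (proj₂ pk) t∈B))
  ... | inj₁ k<ℓ = inj₂ k<ℓ
  ... | inj₂ k≡ℓ = inj₁ (≡.sym k≡ℓ)

module Remainder {n : ℕ} (G : Graph n) (k : ℕ) (adj? : Decidable (Adj G)) where

  open DecMembership (_≟_ {n}) using (_∈?_)

  freeNbrs : Packing n → Fin n → List (Fin n)
  freeNbrs B x = filter (λ u → adj? x u ×-dec ¬? (u ∈? verts B)) (allFin n)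

  ∈-freeNbrs : ∀ {B x u} → u ∈ freeNbrs B x ⇔ (Adj G x u × u ∉ verts B)
  ∈-freeNbrs {B} {x} {u} =
    mk⇔ (proj₂ ∘ ∈-filter⁻ free? {xs = allFin n}) (∈-filter⁺ free? (∈-allFin u))
    where free? = λ u → adj? x u ×-dec ¬? (u ∈? verts B)

  freeNbrs-unique : ∀ B x → Unique (freeNbrs B x)
  freeNbrs-unique B x = Unique.filter⁺ _ (Unique.allFin⁺ n)

  maxStar : Packing n → Fin n → StarG n
  maxStar B x = star x (freeNbrs B x)

  collectStep-maxStar : ∀ {B x} → x ∉ verts B → k ≤ length (freeNbrs B x) →
                        CollectStep G k B (maxStar B x)
  collectStep-maxStar {B} {x} x∉ len = x∉ , (λ _ → ∈-freeNbrs {B} {x}) , freeNbrs-unique B x , len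

  sats-⊆-freeNbrs : ∀ {B t} → InRemainder G B t → sats t ⊆ freeNbrs B (center t)
  sats-⊆-freeNbrs {B} {t} (_ , _ , nbrs) u∈t =
    Equivalence.from (∈-freeNbrs {B} {center t}) (All.lookup nbrs u∈t)

  length-sats≤freeNbrs : ∀ {B t} → InRemainder G B t → length (sats t) ≤ length (freeNbrs B (center t))
  length-sats≤freeNbrs {B} {t} r@(_ , uniq , _) = Unique-⊆⇒length-≤ uniq (sats-⊆-freeNbrs {B} {t} r)

  freeNbrs-∷-⊆ : ∀ {s B x} → freeNbrs (s ∷ B) x ⊆ freeNbrs B x
  freeNbrs-∷-⊆ {s} {B} {x} m with adj , u∉ ← Equivalence.to (∈-freeNbrs {s ∷ B} {x}) m =
    Equivalence.from (∈-freeNbrs {B} {x}) (adj , u∉ ∘ ∈-++⁺ʳ (starVerts s))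

  collectible : ∀ {B t} → InRemainder G B t → k ≤ length (sats t) →
                ∃[ t′ ] (CollectStep G k B t′ × length (sats t) ≤ length (sats t′))
  collectible {B} {t} r@(x∉ , _) k≤t =
    maxStar B (center t) , collectStep-maxStar {B} x∉ (≤-trans k≤t ℓ≤) , ℓ≤
    where ℓ≤ = length-sats≤freeNbrs {B} {t} r

  BigCollectible : Packing n → Set
  BigCollectible B = ∃[ t ] (CollectStep G k B t × suc k ≤ length (sats t))

  length-freeNbrs≤k : ∀ {B x} → ¬ BigCollectible B → x ∉ verts B → length (freeNbrs B x) ≤ k
  length-freeNbrs≤k {B} {x} noBig x∉ =
    ≮⇒≥ λ k<ℓ → noBig (maxStar B x , collectStep-maxStar {B} x∉ (<⇒≤ k<ℓ) , k<ℓ)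

  -- Without a (k+1)⁺-star to collect, the first Collect takes exactly the satellites of t₁
  -- (by pigeonhole), so t₂ survives it intact.
  collect-two-kStars : ∀ {B t₁ t₂} → ¬ BigCollectible B →
                       InRemainder G B t₁ → InRemainder G B t₂ → Disjoint (starVerts t₁) (starVerts t₂) →
                       k ≤ length (sats t₁) → k ≤ length (sats t₂) →
                       ∃₂ λ u₁ u₂ → Collects G k B (u₁ ∷ u₂ ∷ []) ×
                                    length (sats u₁) ≡ k × length (sats u₂) ≡ k
  collect-two-kStars {B} {t₁} {t₂} noBig r₁@(x₁∉ , uniq₁ , _) r₂ disj k≤₁ k≤₂ =
    maxStar B x₁ , maxStar B₁ x₂ ,
    step (collectStep-maxStar {B} x₁∉ k≤N₁) (step (collectStep-maxStar {B₁} x₂∉ k≤N₂) done) ,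
    ≤-antisym N₁≤k k≤N₁ , ≤-antisym N₂≤k k≤N₂
    where
    x₁ = center t₁
    x₂ = center t₂
    B₁ = maxStar B x₁ ∷ B
    N₁≤k : length (freeNbrs B x₁) ≤ k
    N₁≤k = length-freeNbrs≤k {B} noBig x₁∉
    k≤N₁ : k ≤ length (freeNbrs B x₁)
    k≤N₁ = ≤-trans k≤₁ (length-sats≤freeNbrs {B} {t₁} r₁)
    t₂-avoids : Disjoint (starVerts t₂) (starVerts (maxStar B x₁))
    t₂-avoids (u∈t₂ , here refl)   = disj (here refl , u∈t₂)
    t₂-avoids (u∈t₂ , there u∈N₁) =
      <⇒≱ (Unique-⊆-∉⇒length-< uniq₁ (sats-⊆-freeNbrs {B} {t₁} r₁) u∈N₁
             λ u∈t₁ → disj (there u∈t₁ , u∈t₂))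
          (≤-trans N₁≤k k≤₁)
    r₂′ : InRemainder G B₁ t₂
    r₂′ = InRemainder-∷ {G = G} {B = B} r₂ t₂-avoids
    x₂∉ = proj₁ r₂′
    k≤N₂ : k ≤ length (freeNbrs B₁ x₂)
    k≤N₂ = ≤-trans k≤₂ (length-sats≤freeNbrs {B₁} {t₂} r₂′)
    N₂≤k : length (freeNbrs B₁ x₂) ≤ k
    N₂≤k = begin
      length (freeNbrs B₁ x₂) ≤⟨ Unique-⊆⇒length-≤ (freeNbrs-unique B₁ x₂) (freeNbrs-∷-⊆ {_} {B}) ⟩
      length (freeNbrs B x₂)  ≤⟨ length-freeNbrs≤k {B} noBig (proj₁ r₂) ⟩
      k                       ∎
      where open ≤-Reasoning

-- No Pull operation applies to the output

module LocalOptimum {n : ℕ} (G : Graph n) (k : ℕ) (P : Packing n)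
                    (pk : IsKStarPacking k G P) (stuck : ∀ P′ → ¬ Op G k P P′) where

  Freed : List (Fin n) → Fin n → Set
  Freed S u = u ∉ verts P ⊎ u ∈ S

  released : ∀ {S} B → verts P ↭ S ++ verts B → ∀ {t} → StarIn G (Freed S) t → InRemainder G B t
  released B split = StarIn-mono {G = G} λ _ → ↭-++⇒∉ʳ (proj₁ pk) split

  pullBig-inapplicable : ∀ {s v t} → s ∈ P → suc k ≤ length (sats s) → v ∈ sats s →
                         StarIn G (Freed [ v ]) t → k ≤ length (sats t) → ⊥
  pullBig-inapplicable {s} {v} {t} s∈P big v∈s t-freed k≤t
    with rest , P↭ ← ∈⇒↭-∷ s∈P | xs , ys , eq ← ∈-∃++ v∈s =
    ¬¬-decidable (Adj G) λ adj? →
      let _ , c , _ = Remainder.collectible G k adj? {P′} {t} (released P′ split t-freed) k≤t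
      in stuck _ (pullBig P↭ eq big c)
    where
    P′ = star (center s) (xs ++ ys) ∷ rest
    split = ↭-trans (verts-↭ P↭) (verts-removeSatellite {rest = rest} eq)

  pullK-inapplicable : ∀ {s t} → s ∈ P → length (sats s) ≡ k →
                       StarIn G (Freed (starVerts s)) t → suc k ≤ length (sats t) → ⊥
  pullK-inapplicable {s} {t} s∈P len t-freed k<t with rest , P↭ ← ∈⇒↭-∷ s∈P =
    ¬¬-decidable (Adj G) λ adj? →
      let _ , c , t≤ = Remainder.collectible G k adj? {rest} {t}
                         (released rest (verts-↭ P↭) t-freed) (<⇒≤ k<t)
      in stuck _ (pullK₁ P↭ len c (≤-trans k<t t≤))

  pullK-inapplicable₂ : ∀ {s t₁ t₂} → s ∈ P → length (sats s) ≡ k →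
                        StarIn G (Freed (starVerts s)) t₁ → StarIn G (Freed (starVerts s)) t₂ →
                        Disjoint (starVerts t₁) (starVerts t₂) →
                        k ≤ length (sats t₁) → k ≤ length (sats t₂) → ⊥
  pullK-inapplicable₂ {s} {t₁} {t₂} s∈P len t₁-freed t₂-freed disj k≤₁ k≤₂
    with rest , P↭ ← ∈⇒↭-∷ s∈P =
    ¬¬-decidable (Adj G) λ adj? → ¬¬-excluded-middle {A = Remainder.BigCollectible G k adj? rest} λ where
      (yes (_ , c , big)) → stuck _ (pullK₁ P↭ len c big)
      (no noBig) →
        let _ , _ , cs , len₁ , len₂ =
              Remainder.collect-two-kStars G k adj? {rest} {t₁} {t₂} noBig
                (released rest (verts-↭ P↭) t₁-freed) (released rest (verts-↭ P↭) t₂-freed)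
                disj k≤₁ k≤₂
        in stuck _ (pullK₂ P↭ len noBig cs len₁ len₂)

module Type1Stars {n : ℕ} (G : Graph n) (k : ℕ) (1≤k : 1 ≤ k) (P Q : Packing n)
                  (pk : IsKStarPacking k G P) (stuck : ∀ P′ → ¬ Op G k P P′)
                  (closed : Closed G P) (qk : IsKStarPacking k G Q) where

  open LocalOptimum G k P pk stuck
  open DecMembership (_≟_ {n}) using (_∈?_)
  module Pk = KStarPacking {G = G} {k} {P} pk
  module Qk = KStarPacking {G = G} {k} {Q} qk

  IsType1 : StarG n → Set
  IsType1 t = t ∈ Q × uncovCount P t ≡ k

  uncoveredSats : StarG n → List (Fin n)
  uncoveredSats t = filter (λ u → ¬? (u ∈? verts P)) (sats t)

  ∈-uncoveredSats⁻ : ∀ {t u} → u ∈ uncoveredSats t → u ∈ sats t × u ∉ verts P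
  ∈-uncoveredSats⁻ {t} = ∈-filter⁻ (λ u → ¬? (u ∈? verts P)) {xs = sats t}

  covered∉uncoveredSats : ∀ {t u} → u ∈ verts P → u ∉ uncoveredSats t
  covered∉uncoveredSats {t} u∈P m = proj₂ (∈-uncoveredSats⁻ {t} m) u∈P

  uncovCount-coveredCenter : ∀ {t} → center t ∈ verts P →
                             uncovCount P t ≡ length (uncoveredSats t)
  uncovCount-coveredCenter x∈P =
    cong length (filter-reject (λ u → ¬? (u ∈? verts P)) λ x∉P → x∉P x∈P)

  uncovCount-uncoveredCenter : ∀ {t} → center t ∉ verts P →
                               uncovCount P t ≡ suc (length (uncoveredSats t))
  uncovCount-uncoveredCenter x∉P = cong length (filter-accept (λ u → ¬? (u ∈? verts P)) x∉P)

  StarIn-uncoveredSats : ∀ {S t} → t ∈ Q → Freed S (center t) →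
                         StarIn G (Freed S) (star (center t) (uncoveredSats t))
  StarIn-uncoveredSats {t = t} t∈Q x-freed =
    x-freed , Unique.filter⁺ _ (Qk.sats-unique t∈Q) ,
    All.tabulate λ m → let u∈t , u∉P = ∈-uncoveredSats⁻ {t} m
                       in Qk.center-adjacent t∈Q u∈t , inj₁ u∉P

  length-uncoveredSats : ∀ {t} → IsType1 t → center t ∈ verts P → length (uncoveredSats t) ≡ k
  length-uncoveredSats (_ , uc) x∈P = ≡.trans (≡.sym (uncovCount-coveredCenter x∈P)) uc

  type1-center-uncovered : ∀ {t} → IsType1 t → center t ∉ verts P
  type1-center-uncovered {t} type1@(t∈Q , _) x∈P with ∈-concatMap⁻′ starVerts x∈P
  ... | s , s∈P , here x≡cs
    with u , u∈ ← ∃∈-of-length-≥1 (subst (1 ≤_) (≡.sym (length-uncoveredSats type1 x∈P)) 1≤k)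
    with u∈t , u∉P ← ∈-uncoveredSats⁻ {t} u∈
    = u∉P (closed s s∈P u (subst (λ z → Adj G z u) x≡cs (Qk.center-adjacent t∈Q u∈t)))
  ... | s , s∈P , there x∈s with Pk.kStar⊎bigStar s∈P
  ...   | inj₁ len≡k =
    pullK-inapplicable s∈P len≡k
      (StarIn-∷ {G = G} (StarIn-uncoveredSats t∈Q (inj₂ (there x∈s)))
                (sym G (Pk.center-adjacent s∈P x∈s)) (inj₂ (here refl))
                (covered∉uncoveredSats {t} (∈-concatMap⁺′ starVerts s∈P (here refl))))
      (s≤s (≤-reflexive (≡.sym (length-uncoveredSats type1 x∈P))))
  ...   | inj₂ big =
    pullBig-inapplicable s∈P big x∈s (StarIn-uncoveredSats t∈Q (inj₂ (here refl)))
      (≤-reflexive (≡.sym (length-uncoveredSats type1 x∈P)))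

  cStar : StarG n → Fin n → StarG n
  cStar t c = star (center t) (c ∷ uncoveredSats t)

  length-cStar : ∀ {t} c → IsType1 t → length (sats (cStar t c)) ≡ k
  length-cStar _ type1@(_ , uc) =
    ≡.trans (≡.sym (uncovCount-uncoveredCenter (type1-center-uncovered type1))) uc

  StarIn-cStar : ∀ {S t c} → IsType1 t → c ∈ sats t → c ∈ verts P → c ∈ S →
                 StarIn G (Freed S) (cStar t c)
  StarIn-cStar {t = t} type1@(t∈Q , _) c∈t c∈P c∈S =
    StarIn-∷ {G = G} (StarIn-uncoveredSats t∈Q (inj₁ (type1-center-uncovered type1)))
             (Qk.center-adjacent t∈Q c∈t) (inj₂ c∈S) (covered∉uncoveredSats {t} c∈P)

  cStar-⊆ : ∀ {t c} → c ∈ sats t → starVerts (cStar t c) ⊆ starVerts t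
  cStar-⊆     c∈t (here refl)         = here refl
  cStar-⊆     c∈t (there (here refl)) = there c∈t
  cStar-⊆ {t} c∈t (there (there m))   = there (proj₁ (∈-uncoveredSats⁻ {t} m))

  ∈-cVertices⁻ : ∀ {c} → c ∈ cVertices k P Q → ∃[ t ] (IsType1 t × c ∈ sats t × c ∈ verts P)
  ∈-cVertices⁻ m with t , t∈T₁ , c∈ ← ∈-concatMap⁻′ _ m =
    t , ∈-filter⁻ _ {xs = Q} t∈T₁ , ∈-filter⁻ _ {xs = sats t} c∈

  length-cVertices : length (cVertices k P Q) ≡ Apx₁ k P Q
  length-cVertices = length-concatMap _ _ (All.tabulate λ t∈T₁ →
    let x∉P = type1-center-uncovered (∈-filter⁻ _ {xs = Q} t∈T₁)
    in cong length (≡.sym (filter-reject (λ u → u ∈? verts P) x∉P)))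

  cVertex-in-kStar : ∀ c → c ∈ cVertices k P Q → ∃[ s ] (s ∈ P × length (sats s) ≡ k × c ∈ sats s)
  cVertex-in-kStar c c∈cV with t , type1@(t∈Q , _) , c∈t , c∈P ← ∈-cVertices⁻ c∈cV
    with ∈-concatMap⁻′ starVerts c∈P
  ... | s , s∈P , here c≡cs =
    ⊥-elim (type1-center-uncovered type1 (closed s s∈P (center t)
      (subst (λ z → Adj G z (center t)) c≡cs (sym G (Qk.center-adjacent t∈Q c∈t)))))
  ... | s , s∈P , there c∈s with Pk.kStar⊎bigStar s∈P
  ...   | inj₁ len≡k = s , s∈P , len≡k , c∈s
  ...   | inj₂ big   =
    ⊥-elim (pullBig-inapplicable s∈P big c∈s (StarIn-cStar type1 c∈t c∈P (here refl))
                                 (≤-reflexive (≡.sym (length-cStar c type1))))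

  cVertices-in-distinct-kStars : ∀ c c′ s → c ∈ cVertices k P Q → c′ ∈ cVertices k P Q →
                                 c ≢ c′ → s ∈ P → length (sats s) ≡ k →
                                 c ∈ starVerts s → c′ ∈ starVerts s → ⊥
  cVertices-in-distinct-kStars c c′ s c∈cV c′∈cV c≢c′ s∈P len c∈s c′∈s
    with t , type1 , c∈t , c∈P ← ∈-cVertices⁻ c∈cV
    with t′ , type1′@(t′∈Q , _) , c′∈t′ , c′∈P ← ∈-cVertices⁻ c′∈cV
    with center t ≟ center t′
  ... | yes x≡x′ =
    pullK-inapplicable s∈P len
      (StarIn-∷ {G = G} (StarIn-cStar type1 c∈t c∈P c∈s) adj (inj₂ c′∈s) c′∉)
      (s≤s (≤-reflexive (≡.sym (length-cStar c type1))))
    where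
    adj = subst (λ z → Adj G z c′) (≡.sym x≡x′) (Qk.center-adjacent t′∈Q c′∈t′)
    c′∉ : c′ ∉ c ∷ uncoveredSats t
    c′∉ (here c′≡c) = c≢c′ (≡.sym c′≡c)
    c′∉ (there m)   = covered∉uncoveredSats {t} c′∈P m
  ... | no x≢x′ =
    pullK-inapplicable₂ s∈P len
      (StarIn-cStar type1 c∈t c∈P c∈s) (StarIn-cStar type1′ c′∈t′ c′∈P c′∈s)
      (λ (u∈ , u∈′) → Qk.stars-disjoint (proj₁ type1) t′∈Q x≢x′ (cStar-⊆ c∈t u∈ , cStar-⊆ c′∈t′ u∈′))
      (≤-reflexive (≡.sym (length-cStar c type1))) (≤-reflexive (≡.sym (length-cStar c′ type1′)))

lemma4 : ∀ {n} (k : ℕ) → 2 ≤ k → (G : Graph n) (P Q : Packing n) →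
    IsOutput G k P → IsMaxKStarPacking k G Q →
    (length (cVertices k P Q) ≡ Apx₁ k P Q) ×
    (∀ c → c ∈ cVertices k P Q →
      ∃[ s ] (s ∈ P × length (sats s) ≡ k × c ∈ sats s)) ×
    (∀ c c' s → c ∈ cVertices k P Q → c' ∈ cVertices k P Q → c ≢ c' →
      s ∈ P → length (sats s) ≡ k → c ∈ starVerts s → c' ∈ starVerts s → ⊥)
lemma4 k 2≤k G P Q (reachable , stuck) (qk , _) =
  length-cVertices , cVertex-in-kStar , cVertices-in-distinct-kStars
  where
  open Type1Stars G k (≤-trans (n≤1+n 1) 2≤k) P Q
    (reachable⇒IsKStarPacking reachable) stuck (reachable⇒Closed reachable) qk
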